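{- Let $(G,A,\pi)$ be a linear SDS over a field $\mathbb{K}$ with $G$ having vertices $v_1,\dots,v_n$, $A=(a_{ij})$, and $\pi$ a permutation of the vertices; let $D=\mathrm{diag}\{a_{11},\dots,a_{nn}\}$. Then the map $(G,A,\pi):\mathbb{K}^n\to\mathbb{K}^n$ is invertible if and only if $a_{ii}\neq 0$ for all $1\le i\le n$, and in that case $$(G,A,\pi)^{ -1}=(G,B,\pi^{[r]}),$$ where $B$ is the $n\times n$ matrix determined by $B_{\pi^{[r]}}=-D^{ -1}A_{\pi^{[r]}}$, $B_\pi=-D^{ -1}A_\pi$ and $\mathrm{Diag}\{B\}=D^{ -1}$.
   Context: A linear SDS $(G,A,\pi)$: $G$ is a connected simple graph with vertices $v_1,\dots,v_n$; $A=(a_{ij})$ is an $n\times n$ matrix over $\mathbb{K}$ with $a_{ij}=0$ whenever $i\neq j$ and $v_i,v_j$ are not adjacent; the local function of $v_i$ is $x_i\mapsto a_{i1}x_1+\cdots+a_{in}x_n$, inducing the matrix $F_{v_i}$ equal to the identity except that its $i$-th row is $(a_{i1},\dots,a_{in})$. For a permutation $\pi=\pi_1\cdots\pi_n$ of the vertices, the system map is $(G,A,\pi)=F_{\pi_n}\cdots F_{\pi_1}$. The reversed schedule is $\pi^{[r]}=\pi_n\cdots\pi_2\pi_1$. For an $n\times n$ matrix $T$ with rows and columns indexed by $v_1,\dots,v_n$ and a permutation $\sigma$ of the vertices, $T_\sigma$ is the matrix with $[T_\sigma]_{ij}=[T]_{ij}$ if $v_i$ appears after $v_j$ in $\sigma$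 and $[T_\sigma]_{ij}=0$ otherwise. $\mathrm{Diag}\{B\}$ denotes the diagonal matrix with the diagonal entries of $B$. (Note $B=\mathrm{Diag}\{B\}+B_\pi+B_{\pi^{[r]}}$.) -}

module Defs where

open import Level using (Level; _⊔_) renaming (suc to lsuc)
open import Algebra.Bundles using (CommutativeRing)
open import Data.Nat.Base using (ℕ)
open import Data.Fin.Base using (Fin; opposite; _<_)
open import Data.Fin.Properties using (opposite-involutive; _<?_) renaming (_≟_ to _≟ᶠ_)
open import Data.Fin.Permutation using (Permutation′; permutation; _⟨$⟩ʳ_; _⟨$⟩ˡ_; inverseˡ; inverseʳ)
open import Data.List.Base using (List; foldl; foldr)
open import Data.List using (allFin)
open import Data.Product.Base using (Σ; _×_)
open import Relation.Nullary using (¬_; yes; no)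
open import Relation.Binary.PropositionalEquality using (_≡_; _≢_; cong; trans)

record Field (c ℓ : Level) : Set (lsuc (c ⊔ ℓ)) where
  field
    commutativeRing : CommutativeRing c ℓ
  open CommutativeRing commutativeRing public
  field
    1≉0     : ¬ (1# ≈ 0#)
    inv     : (x : Carrier) → ¬ (x ≈ 0#) → Carrier
    inv-r   : (x : Carrier) (p : ¬ (x ≈ 0#)) → x * inv x p ≈ 1#

-- Finite simple connected graphs on vertex set Fin n (v_i ↔ i).

data Walk {n : ℕ} (Adj : Fin n → Fin n → Set) : Fin n → Fin n → Set where
  here : ∀ {u} → Walk Adj u u
  step : ∀ {u v w} → Adj u v → Walk Adj v w → Walk Adj u w

record ConnectedSimpleGraph (n : ℕ) : Set₁ where
  field
    Adj       : Fin n → Fin n → Set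
    sym       : ∀ {u v} → Adj u v → Adj v u
    irrefl    : ∀ {u} → ¬ Adj u u
    connected : ∀ u v → Walk Adj u v

module _ {c ℓ : Level} (K : Field c ℓ) where
  open Field K

  Matrix : ℕ → Set c
  Matrix n = Fin n → Fin n → Carrier

  _≈M_ : ∀ {n} → Matrix n → Matrix n → Set ℓ
  M ≈M N = ∀ i j → M i j ≈ N i j

  Σᶠ : ∀ {n} → (Fin n → Carrier) → Carrier
  Σᶠ {n} f = foldr (λ k acc → f k + acc) 0# (allFin n)

  _*M_ : ∀ {n} → Matrix n → Matrix n → Matrix n
  (M *M N) i j = Σᶠ (λ k → M i k * N k j)

  I : ∀ {n} → Matrix n
  I i j with i ≟ᶠ j
  ... | yes _ = 1#
  ... | no  _ = 0#

  -M_ : ∀ {n} → Matrix n → Matrix n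
  (-M M) i j = - M i j

  Diag : ∀ {n} → Matrix n → Matrix n
  Diag M i j with i ≟ᶠ j
  ... | yes _ = M i j
  ... | no  _ = 0#

  Dinv : ∀ {n} (A : Matrix n) → (∀ i → ¬ (A i i ≈ 0#)) → Matrix n
  Dinv A nz i j with i ≟ᶠ j
  ... | yes _ = inv (A i i) (nz i)
  ... | no  _ = 0#

  IsLinearSDS : ∀ {n} → ConnectedSimpleGraph n → Matrix n → Set ℓ
  IsLinearSDS G A = ∀ i j → i ≢ j → ¬ ConnectedSimpleGraph.Adj G i j → A i j ≈ 0#

  F : ∀ {n} → Matrix n → Fin n → Matrix n
  F A v i j with i ≟ᶠ v
  ... | yes _ = A i j
  ... | no  _ = I i j

  -- A schedule π is a permutation: π ⟨$⟩ʳ k is the vertex at position k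
  -- (so π = π_1 ⋯ π_n with π_{k+1} = π ⟨$⟩ʳ k), and π ⟨$⟩ˡ v is the
  -- position of v.
  sysMap : ∀ {n} → Matrix n → Permutation′ n → Matrix n
  sysMap {n} A π = foldl (λ M k → F A (π ⟨$⟩ʳ k) *M M) I (allFin n)

  restrict : ∀ {n} → Matrix n → Permutation′ n → Matrix n
  restrict T σ i j with (σ ⟨$⟩ˡ j) <? (σ ⟨$⟩ˡ i)
  ... | yes _ = T i j
  ... | no  _ = 0#

  Invertible : ∀ {n} → Matrix n → Set (c ⊔ ℓ)
  Invertible {n} M = Σ (Matrix n) (λ N → ((M *M N) ≈M I) × ((N *M M) ≈M I))

  IsInverseOf : ∀ {n} → Matrix n → Matrix n → Set ℓ
  IsInverseOf N M = ((M *M N) ≈M I) × ((N *M M) ≈M I)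

reverseπ : ∀ {n} → Permutation′ n → Permutation′ n
reverseπ π = permutation (λ k → π ⟨$⟩ʳ opposite k) (λ v → opposite (π ⟨$⟩ˡ v))
  (λ v → trans (cong (λ x → π ⟨$⟩ʳ x) (opposite-involutive _)) (inverseʳ π))
  (λ k → trans (cong opposite (inverseˡ π)) (opposite-involutive k))

module Submission where

-- Write F_v for the update matrix of vertex v (the identity
-- with its v-th row replaced by the v-th row of A).  The system map is the
-- composite F_{π_n} ⋯ F_{π_1}, and the system map of the reversed schedule
-- with coefficients B is F^B_{π_1} ⋯ F^B_{π_n}.  Everything therefore
-- reduces to one vertex at a time:
--   * if a_vv = 0 the v-th column of F_v vanishes, so F_v has no left
--     inverse; if a_vv ≠ 0, F_v is inverted by F^Y_v for any Y whose v-th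
--     row is a_vv⁻¹ on the diagonal and −a_vv⁻¹ a_vj elsewhere ("Y inverts
--     row v of A");
--   * in any monoid, g_k ⋯ g_1 is inverted by h_1 ⋯ h_k when each h_i
--     inverts g_i, and in a left invertible composite every factor that can
--     be inverted on the right can be peeled off, so each factor is left
--     invertible;
--   * the hypotheses on B_{π^[r]}, B_π and Diag{B} say exactly that B
--     inverts every row of A, since each off-diagonal position (v,j) lies
--     below the diagonal of π or of π^[r].

open import Defs
open import Level using (Level)
open import Algebra.Bundles using (Monoid)
open import Data.Nat.Base using (ℕ; zero; suc)
import Data.Nat.Base as ℕ
import Data.Nat.Properties as ℕ
open import Data.Fin.Base using (Fin; zero; suc; opposite; fromℕ; inject₁; toℕ; _<_; punchIn)
open import Data.Fin.Properties using (toℕ<n; opposite-prop; <-cmp; _<?_; punchInᵢ≢i) renaming (_≟_ to _≟ᶠ_)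
open import Data.Fin.Permutation using (Permutation′; _⟨$⟩ʳ_; _⟨$⟩ˡ_; inverseʳ)
open import Data.List.Base using (List; []; _∷_; foldl; foldr; tabulate; allFin)
open import Data.List.Relation.Unary.All using (All; []; _∷_)
open import Data.List.Relation.Unary.All.Properties using (tabulate⁻)
open import Data.List.Properties using (foldl-map; map-tabulate)
open import Data.Product.Base using (Σ; _×_; _,_; proj₁; proj₂)
open import Data.Empty using (⊥-elim)
open import Data.Sum.Base using (_⊎_; inj₁; inj₂)
open import Function.Base using (_∘_; flip; id)
open import Function.Bundles using (_⇔_; mk⇔)
open import Relation.Binary.Definitions using (tri<; tri≈; tri>)
open import Relation.Nullary using (¬_; Dec; yes; no)
import Relation.Binary.PropositionalEquality as ≡
open ≡ using (_≡_; _≢_)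

module Composites {c ℓ} (M : Monoid c ℓ) where
  open Monoid M
  open import Algebra.Properties.Monoid M using (cancelᶜ)
  open import Relation.Binary.Reasoning.Setoid setoid

  module _ {a} {X : Set a} where
    composite : (X → Carrier) → List X → Carrier
    composite g = foldl (λ acc x → g x ∙ acc) ε

    product : (X → Carrier) → List X → Carrier
    product h = foldr (λ x acc → h x ∙ acc) ε

    composite-from : ∀ (g : X → Carrier) xs z →
      foldl (λ acc x → g x ∙ acc) z xs ≈ composite g xs ∙ z
    composite-from g []       z = sym (identityˡ z)
    composite-from g (x ∷ xs) z = begin
      foldl (λ acc y → g y ∙ acc) (g x ∙ z) xs ≈⟨ composite-from g xs (g x ∙ z) ⟩
      composite g xs ∙ (g x ∙ z)               ≈⟨ assoc _ _ _ ⟨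
      (composite g xs ∙ g x) ∙ z               ≈⟨ ∙-congʳ (∙-congˡ (identityʳ (g x))) ⟨
      (composite g xs ∙ (g x ∙ ε)) ∙ z         ≈⟨ ∙-congʳ (composite-from g xs (g x ∙ ε)) ⟨
      composite g (x ∷ xs) ∙ z                 ∎

    composite-∷ : ∀ (g : X → Carrier) x xs → composite g (x ∷ xs) ≈ composite g xs ∙ g x
    composite-∷ g x xs = trans (composite-from g xs (g x ∙ ε)) (∙-congˡ (identityʳ (g x)))

    composite-inverse : ∀ (g h : X → Carrier) →
      (∀ x → g x ∙ h x ≈ ε) → (∀ x → h x ∙ g x ≈ ε) → ∀ xs →
      (composite g xs ∙ product h xs ≈ ε) × (product h xs ∙ composite g xs ≈ ε)
    composite-inverse g h gh hg []       = identityˡ ε , identityˡ ε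
    composite-inverse g h gh hg (x ∷ xs) = right , left
      where
      C = composite g xs
      P = product h xs
      ih = composite-inverse g h gh hg xs
      right : composite g (x ∷ xs) ∙ (h x ∙ P) ≈ ε
      right = begin
        composite g (x ∷ xs) ∙ (h x ∙ P) ≈⟨ ∙-congʳ (composite-∷ g x xs) ⟩
        (C ∙ g x) ∙ (h x ∙ P)            ≈⟨ cancelᶜ (gh x) C P ⟩
        C ∙ P                            ≈⟨ proj₁ ih ⟩
        ε                                ∎
      left : (h x ∙ P) ∙ composite g (x ∷ xs) ≈ ε
      left = begin
        (h x ∙ P) ∙ composite g (x ∷ xs) ≈⟨ ∙-congˡ (composite-∷ g x xs) ⟩
        (h x ∙ P) ∙ (C ∙ g x)            ≈⟨ cancelᶜ (proj₂ ih) (h x) (g x) ⟩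
        h x ∙ g x                        ≈⟨ hg x ⟩
        ε                                ∎

    peel-first : ∀ {N P G H} → N ∙ (P ∙ G) ≈ ε → G ∙ H ≈ ε → (G ∙ N) ∙ P ≈ ε
    peel-first {N} {P} {G} {H} NPG GH = begin
      (G ∙ N) ∙ P              ≈⟨ identityʳ _ ⟨
      ((G ∙ N) ∙ P) ∙ ε        ≈⟨ ∙-congˡ GH ⟨
      ((G ∙ N) ∙ P) ∙ (G ∙ H)  ≈⟨ assoc _ _ _ ⟨
      (((G ∙ N) ∙ P) ∙ G) ∙ H  ≈⟨ ∙-congʳ (trans (∙-congʳ (assoc G N P)) (assoc G (N ∙ P) G)) ⟩
      (G ∙ ((N ∙ P) ∙ G)) ∙ H  ≈⟨ ∙-congʳ (∙-congˡ (trans (assoc N P G) NPG)) ⟩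
      (G ∙ ε) ∙ H              ≈⟨ ∙-congʳ (identityʳ G) ⟩
      G ∙ H                    ≈⟨ GH ⟩
      ε                        ∎

    composite-leftInverse⇒All : ∀ {q} (g : X → Carrier) (Q : X → Set q) →
      (∀ {x L} → L ∙ g x ≈ ε → Q x) →
      (∀ {x} → Q x → Σ Carrier (λ H → g x ∙ H ≈ ε)) →
      ∀ xs {N} → N ∙ composite g xs ≈ ε → All Q xs
    composite-leftInverse⇒All g Q leftInv⇒Q Q⇒rightInv []       _      = []
    composite-leftInverse⇒All g Q leftInv⇒Q Q⇒rightInv (x ∷ xs) {N} NC =
      Qx ∷ composite-leftInverse⇒All g Q leftInv⇒Q Q⇒rightInv xs
             (peel-first NCg (proj₂ (Q⇒rightInv Qx)))
      where
      NCg : N ∙ (composite g xs ∙ g x) ≈ ε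
      NCg = trans (∙-congˡ (sym (composite-∷ g x xs))) NC
      Qx : Q x
      Qx = leftInv⇒Q (trans (assoc N (composite g xs) (g x)) NCg)

module _ {a b} {X : Set a} {Y : Set b} where

  foldl-positions : ∀ {n} (g : Y → X → Y) (f : Fin n → X) z →
    foldl (λ acc k → g acc (f k)) z (allFin n) ≡ foldl g z (tabulate f)
  foldl-positions g f z =
    ≡.trans (≡.sym (foldl-map g f z (allFin _))) (≡.cong (foldl g z) (map-tabulate id f))

  foldr-tabulate-last : ∀ {n} (h : X → Y → Y) z (f : Fin (suc n) → X) →
    foldr h z (tabulate f) ≡ foldr h (h (f (fromℕ n)) z) (tabulate (f ∘ inject₁))
  foldr-tabulate-last {zero}  h z f = ≡.refl
  foldr-tabulate-last {suc n} h z f = ≡.cong (h (f zero)) (foldr-tabulate-last h z (f ∘ suc))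

  foldl-opposite : ∀ {n} (g : Y → X → Y) z (f : Fin n → X) →
    foldl g z (tabulate (f ∘ opposite)) ≡ foldr (flip g) z (tabulate f)
  foldl-opposite {zero}  g z f = ≡.refl
  foldl-opposite {suc n} g z f =
    ≡.trans (foldl-opposite g (g z (f (fromℕ n))) (f ∘ inject₁))
            (≡.sym (foldr-tabulate-last (flip g) z f))

opposite-reverses-< : ∀ {m} {p q : Fin m} → q < p → opposite p < opposite q
opposite-reverses-< {m} {p} {q} q<p =
  ≡.subst₂ ℕ._<_ (≡.sym (opposite-prop p)) (≡.sym (opposite-prop q))
    (ℕ.∸-monoʳ-< {m} {suc (toℕ p)} {suc (toℕ q)} (ℕ.s≤s q<p) (toℕ<n p))

precedes-in-σ-or-reverse : ∀ {n} (σ : Permutation′ n) {v j} → j ≢ v →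
  (σ ⟨$⟩ˡ j < σ ⟨$⟩ˡ v) ⊎ (reverseπ σ ⟨$⟩ˡ j < reverseπ σ ⟨$⟩ˡ v)
precedes-in-σ-or-reverse σ {v} {j} j≢v with <-cmp (σ ⟨$⟩ˡ j) (σ ⟨$⟩ˡ v)
... | tri< j<v _ _ = inj₁ j<v
... | tri≈ _ j≈v _ = ⊥-elim (j≢v (≡.trans (≡.sym (inverseʳ σ))
                                  (≡.trans (≡.cong (σ ⟨$⟩ʳ_) j≈v) (inverseʳ σ))))
... | tri> _ _ v<j = inj₂ (opposite-reverses-< v<j)

module Matrices {c ℓ : Level} (K : Field c ℓ) where
  open Field K hiding (zero)
  open import Algebra.Properties.Semiring.Sum semiring
    using (sum; sum-cong-≋; sum-remove; sum-replicate-zero; ∑-distrib-+; ∑-comm;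
           *-distribˡ-sum; *-distribʳ-sum)
  open import Algebra.Properties.Ring ring using (-0#≈0#; -‿distribʳ-*; x[y-z]≈xy-xz; xyx⁻¹≈y)
  open import Relation.Binary.Reasoning.Setoid setoid

  infixl 7 _⊛_
  infix  4 _≋_

  _⊛_ : ∀ {n} → Matrix K n → Matrix K n → Matrix K n
  _⊛_ = _*M_ K

  _≋_ : ∀ {n} → Matrix K n → Matrix K n → Set ℓ
  _≋_ = _≈M_ K

  Id : ∀ {n} → Matrix K n
  Id = I K

  -- Σᶠ, defined by folding over allFin, is the library's finite sum.
  foldr-tabulate≡sum : ∀ {m n} (h : Fin m → Fin n) (f : Fin n → Carrier) →
    foldr (λ k acc → f k + acc) 0# (tabulate h) ≡ sum (f ∘ h)
  foldr-tabulate≡sum {zero}  h f = ≡.refl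
  foldr-tabulate≡sum {suc m} h f = ≡.cong (f (h zero) +_) (foldr-tabulate≡sum (h ∘ suc) f)

  ⊛-entry : ∀ {n} (M N : Matrix K n) i j → (M ⊛ N) i j ≈ sum (λ k → M i k * N k j)
  ⊛-entry M N i j = reflexive (foldr-tabulate≡sum id (λ k → M i k * N k j))

  sum-single : ∀ {n} (f : Fin n → Carrier) i → (∀ k → k ≢ i → f k ≈ 0#) → sum f ≈ f i
  sum-single {suc n} f i vanish = begin
    sum f                       ≈⟨ sum-remove {i = i} f ⟩
    f i + sum (f ∘ punchIn i)   ≈⟨ +-congˡ (sum-cong-≋ (λ k → vanish _ (punchInᵢ≢i i k))) ⟩
    f i + sum {n} (λ _ → 0#)    ≈⟨ +-congˡ (sum-replicate-zero n) ⟩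
    f i + 0#                    ≈⟨ +-identityʳ (f i) ⟩
    f i                         ∎

  Id-diag : ∀ {n} (i : Fin n) → Id i i ≈ 1#
  Id-diag i with i ≟ᶠ i
  ... | yes _  = refl
  ... | no i≢i = ⊥-elim (i≢i ≡.refl)

  Id-off : ∀ {n} {i j : Fin n} → i ≢ j → Id i j ≈ 0#
  Id-off {i = i} {j} i≢j with i ≟ᶠ j
  ... | yes i≡j = ⊥-elim (i≢j i≡j)
  ... | no _    = refl

  Id-offˡ : ∀ {n} {i j : Fin n} → j ≢ i → Id i j ≈ 0#
  Id-offˡ j≢i = Id-off (j≢i ∘ ≡.sym)

  ⊛-identityˡ : ∀ {n} (M : Matrix K n) → Id ⊛ M ≋ M
  ⊛-identityˡ M i j = begin
    (Id ⊛ M) i j               ≈⟨ ⊛-entry Id M i j ⟩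
    sum (λ k → Id i k * M k j) ≈⟨ sum-single _ i (λ k k≢i → trans (*-congʳ (Id-offˡ k≢i)) (zeroˡ _)) ⟩
    Id i i * M i j             ≈⟨ *-congʳ (Id-diag i) ⟩
    1# * M i j                 ≈⟨ *-identityˡ _ ⟩
    M i j                      ∎

  ⊛-identityʳ : ∀ {n} (M : Matrix K n) → M ⊛ Id ≋ M
  ⊛-identityʳ M i j = begin
    (M ⊛ Id) i j               ≈⟨ ⊛-entry M Id i j ⟩
    sum (λ k → M i k * Id k j) ≈⟨ sum-single _ j (λ k k≢j → trans (*-congˡ (Id-off k≢j)) (zeroʳ _)) ⟩
    M i j * Id j j             ≈⟨ *-congˡ (Id-diag j) ⟩
    M i j * 1#                 ≈⟨ *-identityʳ _ ⟩
    M i j                      ∎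

  ⊛-assoc : ∀ {n} (M N O : Matrix K n) → (M ⊛ N) ⊛ O ≋ M ⊛ (N ⊛ O)
  ⊛-assoc M N O i j = begin
    ((M ⊛ N) ⊛ O) i j                                   ≈⟨ ⊛-entry (M ⊛ N) O i j ⟩
    sum (λ l → (M ⊛ N) i l * O l j)                     ≈⟨ sum-cong-≋ (λ l → *-congʳ (⊛-entry M N i l)) ⟩
    sum (λ l → sum (λ k → M i k * N k l) * O l j)       ≈⟨ sum-cong-≋ (λ l → *-distribʳ-sum (O l j) (λ k → M i k * N k l)) ⟩
    sum (λ l → sum (λ k → M i k * N k l * O l j))       ≈⟨ ∑-comm (λ l k → M i k * N k l * O l j) ⟩
    sum (λ k → sum (λ l → M i k * N k l * O l j))       ≈⟨ sum-cong-≋ (λ k → sum-cong-≋ (λ l → *-assoc (M i k) (N k l) (O l j))) ⟩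
    sum (λ k → sum (λ l → M i k * (N k l * O l j)))     ≈⟨ sum-cong-≋ (λ k → *-distribˡ-sum (M i k) (λ l → N k l * O l j)) ⟨
    sum (λ k → M i k * sum (λ l → N k l * O l j))       ≈⟨ sum-cong-≋ (λ k → *-congˡ (⊛-entry N O k j)) ⟨
    sum (λ k → M i k * (N ⊛ O) k j)                     ≈⟨ ⊛-entry M (N ⊛ O) i j ⟨
    (M ⊛ (N ⊛ O)) i j                                   ∎

  ⊛-cong : ∀ {n} {M M′ N N′ : Matrix K n} → M ≋ M′ → N ≋ N′ → M ⊛ N ≋ M′ ⊛ N′
  ⊛-cong {M = M} {M′} {N} {N′} M≋M′ N≋N′ i j = begin
    (M ⊛ N) i j                  ≈⟨ ⊛-entry M N i j ⟩
    sum (λ k → M i k * N k j)    ≈⟨ sum-cong-≋ (λ k → *-cong (M≋M′ i k) (N≋N′ k j)) ⟩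
    sum (λ k → M′ i k * N′ k j)  ≈⟨ ⊛-entry M′ N′ i j ⟨
    (M′ ⊛ N′) i j                ∎

  matrixMonoid : ℕ → Monoid c ℓ
  matrixMonoid n = record
    { Carrier  = Matrix K n
    ; _≈_      = _≋_
    ; _∙_      = _⊛_
    ; ε        = Id
    ; isMonoid = record
      { isSemigroup = record
        { isMagma = record
          { isEquivalence = record
            { refl  = λ i j → refl
            ; sym   = λ M≋N i j → sym (M≋N i j)
            ; trans = λ M≋N N≋O i j → trans (M≋N i j) (N≋O i j)
            }
          ; ∙-cong = ⊛-cong
          }
        ; assoc = ⊛-assoc
        }
      ; identity = ⊛-identityˡ , ⊛-identityʳ
      }
    }

  F-row : ∀ {n} (X : Matrix K n) v j → F K X v v j ≈ X v j
  F-row X v j with v ≟ᶠ v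
  ... | yes _  = refl
  ... | no v≢v = ⊥-elim (v≢v ≡.refl)

  F-off : ∀ {n} (X : Matrix K n) {v i} j → i ≢ v → F K X v i j ≈ Id i j
  F-off X {v} {i} j i≢v with i ≟ᶠ v
  ... | yes i≡v = ⊥-elim (i≢v i≡v)
  ... | no _    = refl

  F-rankOne : ∀ {n} (X : Matrix K n) v k j → F K X v k j ≈ Id k j + Id k v * (X v j - Id v j)
  F-rankOne X v k j = byCases (k ≟ᶠ v)
    where
    byCases : Dec (k ≡ v) → F K X v k j ≈ Id k j + Id k v * (X v j - Id v j)
    byCases (yes ≡.refl) = begin
      F K X k k j                        ≈⟨ F-row X k j ⟩
      X k j                              ≈⟨ xyx⁻¹≈y (Id k j) (X k j) ⟨
      Id k j + X k j - Id k j            ≈⟨ +-assoc (Id k j) (X k j) (- Id k j) ⟩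
      Id k j + (X k j - Id k j)          ≈⟨ +-congˡ (*-identityˡ _) ⟨
      Id k j + 1# * (X k j - Id k j)     ≈⟨ +-congˡ (*-congʳ (Id-diag k)) ⟨
      Id k j + Id k k * (X k j - Id k j) ∎
    byCases (no k≢v) = begin
      F K X v k j                        ≈⟨ F-off X j k≢v ⟩
      Id k j                             ≈⟨ +-identityʳ _ ⟨
      Id k j + 0#                        ≈⟨ +-congˡ (zeroˡ _) ⟨
      Id k j + 0# * (X v j - Id v j)     ≈⟨ +-congˡ (*-congʳ (Id-off k≢v)) ⟨
      Id k j + Id k v * (X v j - Id v j) ∎

  ⊛F : ∀ {n} (M Y : Matrix K n) v i j → (M ⊛ F K Y v) i j ≈ M i j + M i v * (Y v j - Id v j)
  ⊛F M Y v i j = begin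
    (M ⊛ F K Y v) i j                                        ≈⟨ ⊛-entry M (F K Y v) i j ⟩
    sum (λ k → M i k * F K Y v k j)                          ≈⟨ sum-cong-≋ (λ k → *-congˡ (F-rankOne Y v k j)) ⟩
    sum (λ k → M i k * (Id k j + Id k v * d))                ≈⟨ sum-cong-≋ (λ k → trans (distribˡ (M i k) (Id k j) (Id k v * d)) (+-congˡ (sym (*-assoc (M i k) (Id k v) d)))) ⟩
    sum (λ k → M i k * Id k j + M i k * Id k v * d)          ≈⟨ ∑-distrib-+ (λ k → M i k * Id k j) (λ k → M i k * Id k v * d) ⟩
    sum (λ k → M i k * Id k j) + sum (λ k → M i k * Id k v * d) ≈⟨ +-congˡ (*-distribʳ-sum d (λ k → M i k * Id k v)) ⟨
    sum (λ k → M i k * Id k j) + sum (λ k → M i k * Id k v) * d ≈⟨ +-cong (column j) (*-congʳ (column v)) ⟩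
    M i j + M i v * d                                        ∎
    where
    d = Y v j - Id v j
    column : ∀ l → sum (λ k → M i k * Id k l) ≈ M i l
    column l = trans (sym (⊛-entry M Id i l)) (⊛-identityʳ M i l)

  F⊛F-off : ∀ {n} (X Y : Matrix K n) {v i} j → i ≢ v → (F K X v ⊛ F K Y v) i j ≈ Id i j
  F⊛F-off X Y {v} {i} j i≢v = begin
    (F K X v ⊛ F K Y v) i j                     ≈⟨ ⊛F (F K X v) Y v i j ⟩
    F K X v i j + F K X v i v * (Y v j - Id v j) ≈⟨ +-cong (F-off X j i≢v) (*-congʳ (F-off X v i≢v)) ⟩
    Id i j + Id i v * (Y v j - Id v j)           ≈⟨ +-congˡ (trans (*-congʳ (Id-off i≢v)) (zeroˡ _)) ⟩
    Id i j + 0#                                  ≈⟨ +-identityʳ _ ⟩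
    Id i j                                       ∎

  F⊛F-row : ∀ {n} (X Y : Matrix K n) v j → (F K X v ⊛ F K Y v) v j ≈ X v j + X v v * (Y v j - Id v j)
  F⊛F-row X Y v j = trans (⊛F (F K X v) Y v v j) (+-cong (F-row X v j) (*-congʳ (F-row X v v)))

  record InvertsRow {n} (A : Matrix K n) (y : Fin n → Carrier) (v : Fin n) : Set ℓ where
    field
      pivot       : A v v * y v ≈ 1#
      offDiagonal : ∀ {j} → j ≢ v → y j ≈ - (y v * A v j)

  minus-off : ∀ {n} {v j : Fin n} → j ≢ v → ∀ x → x - Id v j ≈ x
  minus-off j≢v x = trans (+-congˡ (trans (-‿cong (Id-offˡ j≢v)) -0#≈0#)) (+-identityʳ x)

  pivot-product : ∀ x y → x + x * (y - 1#) ≈ x * y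
  pivot-product x y = begin
    x + x * (y - 1#)     ≈⟨ +-congˡ (x[y-z]≈xy-xz x y 1#) ⟩
    x + (x * y - x * 1#) ≈⟨ +-congˡ (+-congˡ (-‿cong (*-identityʳ x))) ⟩
    x + (x * y - x)      ≈⟨ +-assoc x (x * y) (- x) ⟨
    x + x * y - x        ≈⟨ xyx⁻¹≈y x (x * y) ⟩
    x * y                ∎

  F-inverse : ∀ {n} (A Y : Matrix K n) v → InvertsRow A (Y v) v →
    (F K A v ⊛ F K Y v ≋ Id) × (F K Y v ⊛ F K A v ≋ Id)
  F-inverse A Y v inverts = (λ i j → AY (i ≟ᶠ v) (j ≟ᶠ v)) , (λ i j → YA (i ≟ᶠ v) (j ≟ᶠ v))
    where
    open InvertsRow inverts
    b = Y v v
    AY : ∀ {i j} → Dec (i ≡ v) → Dec (j ≡ v) → (F K A v ⊛ F K Y v) i j ≈ Id i j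
    AY {j = j} (no i≢v)   _            = F⊛F-off A Y j i≢v
    AY         (yes ≡.refl) (yes ≡.refl) = begin
      (F K A v ⊛ F K Y v) v v             ≈⟨ F⊛F-row A Y v v ⟩
      A v v + A v v * (b - Id v v)        ≈⟨ +-congˡ (*-congˡ (+-congˡ (-‿cong (Id-diag v)))) ⟩
      A v v + A v v * (b - 1#)            ≈⟨ pivot-product (A v v) b ⟩
      A v v * b                           ≈⟨ pivot ⟩
      1#                                  ≈⟨ Id-diag v ⟨
      Id v v                              ∎
    AY {j = j} (yes ≡.refl) (no j≢v)   = begin
      (F K A v ⊛ F K Y v) v j             ≈⟨ F⊛F-row A Y v j ⟩
      A v j + A v v * (Y v j - Id v j)    ≈⟨ +-congˡ (*-congˡ (minus-off j≢v (Y v j))) ⟩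
      A v j + A v v * Y v j               ≈⟨ +-congˡ (*-congˡ (offDiagonal j≢v)) ⟩
      A v j + A v v * - (b * A v j)       ≈⟨ +-congˡ (-‿distribʳ-* (A v v) (b * A v j)) ⟨
      A v j - A v v * (b * A v j)         ≈⟨ +-congˡ (-‿cong (*-assoc (A v v) b (A v j))) ⟨
      A v j - A v v * b * A v j           ≈⟨ +-congˡ (-‿cong (trans (*-congʳ pivot) (*-identityˡ (A v j)))) ⟩
      A v j - A v j                       ≈⟨ -‿inverseʳ (A v j) ⟩
      0#                                  ≈⟨ Id-offˡ j≢v ⟨
      Id v j                              ∎
    YA : ∀ {i j} → Dec (i ≡ v) → Dec (j ≡ v) → (F K Y v ⊛ F K A v) i j ≈ Id i j
    YA {j = j} (no i≢v)   _            = F⊛F-off Y A j i≢v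
    YA         (yes ≡.refl) (yes ≡.refl) = begin
      (F K Y v ⊛ F K A v) v v             ≈⟨ F⊛F-row Y A v v ⟩
      b + b * (A v v - Id v v)            ≈⟨ +-congˡ (*-congˡ (+-congˡ (-‿cong (Id-diag v)))) ⟩
      b + b * (A v v - 1#)                ≈⟨ pivot-product b (A v v) ⟩
      b * A v v                           ≈⟨ trans (*-comm b (A v v)) pivot ⟩
      1#                                  ≈⟨ Id-diag v ⟨
      Id v v                              ∎
    YA {j = j} (yes ≡.refl) (no j≢v)   = begin
      (F K Y v ⊛ F K A v) v j             ≈⟨ F⊛F-row Y A v j ⟩
      Y v j + b * (A v j - Id v j)        ≈⟨ +-cong (offDiagonal j≢v) (*-congˡ (minus-off j≢v (A v j))) ⟩
      - (b * A v j) + b * A v j           ≈⟨ -‿inverseˡ (b * A v j) ⟩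
      0#                                  ≈⟨ Id-offˡ j≢v ⟨
      Id v j                              ∎

  -- If a_vv ≈ 0 the v-th column of F K A v vanishes, so F K A v is not left
  -- invertible; contrapositively a left invertible F K A v has a_vv ≉ 0.
  F-leftInvertible⇒pivot≉0 : ∀ {n} (A L : Matrix K n) v → L ⊛ F K A v ≋ Id → ¬ (A v v ≈ 0#)
  F-leftInvertible⇒pivot≉0 {n} A L v LF≋Id a≈0 = 1≉0 (begin
    1#                               ≈⟨ Id-diag v ⟨
    Id v v                           ≈⟨ LF≋Id v v ⟨
    (L ⊛ F K A v) v v                ≈⟨ ⊛-entry L (F K A v) v v ⟩
    sum (λ k → L v k * F K A v k v)  ≈⟨ sum-cong-≋ (λ k → trans (*-congˡ (column-v (k ≟ᶠ v))) (zeroʳ (L v k))) ⟩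
    sum {n} (λ _ → 0#)               ≈⟨ sum-replicate-zero n ⟩
    0#                               ∎)
    where
    column-v : ∀ {k} → Dec (k ≡ v) → F K A v k v ≈ 0#
    column-v (yes ≡.refl) = trans (F-row A v v) a≈0
    column-v (no k≢v)     = trans (F-off A v k≢v) (Id-off k≢v)

  invertsRow-zeros : ∀ {n} {A : Matrix K n} {y v j} → InvertsRow A y v → j ≢ v →
    A v j ≈ 0# → y j ≈ 0#
  invertsRow-zeros {A = A} {y} {v} {j} inverts j≢v a≈0 = begin
    y j                ≈⟨ InvertsRow.offDiagonal inverts j≢v ⟩
    - (y v * A v j)    ≈⟨ -‿cong (trans (*-congˡ a≈0) (zeroʳ (y v))) ⟩
    - 0#               ≈⟨ -0#≈0# ⟩
    0#                 ∎

  invertingRow : ∀ {n} (A : Matrix K n) v → ¬ (A v v ≈ 0#) → Fin n → Carrier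
  invertingRow A v a≉0 j with j ≟ᶠ v
  ... | yes _ = inv (A v v) a≉0
  ... | no _  = - (inv (A v v) a≉0 * A v j)

  invertingRow-inverts : ∀ {n} (A : Matrix K n) v a≉0 → InvertsRow A (invertingRow A v a≉0) v
  invertingRow-inverts A v a≉0 = record
    { pivot       = trans (*-congˡ diagonal) (inv-r (A v v) a≉0)
    ; offDiagonal = λ j≢v → trans (off j≢v) (-‿cong (*-congʳ (sym diagonal)))
    }
    where
    diagonal : invertingRow A v a≉0 v ≈ inv (A v v) a≉0
    diagonal with v ≟ᶠ v
    ... | yes _  = refl
    ... | no v≢v = ⊥-elim (v≢v ≡.refl)
    off : ∀ {j} → j ≢ v → invertingRow A v a≉0 j ≈ - (inv (A v v) a≉0 * A v j)
    off {j} j≢v with j ≟ᶠ v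
    ... | yes j≡v = ⊥-elim (j≢v j≡v)
    ... | no _    = refl

  restrict-below : ∀ {n} (T : Matrix K n) σ {i j} → σ ⟨$⟩ˡ j < σ ⟨$⟩ˡ i → restrict K T σ i j ≈ T i j
  restrict-below T σ {i} {j} j<i with (σ ⟨$⟩ˡ j) <? (σ ⟨$⟩ˡ i)
  ... | yes _   = refl
  ... | no j≮i  = ⊥-elim (j≮i j<i)

  Diag-diag : ∀ {n} (B : Matrix K n) v → Diag K B v v ≈ B v v
  Diag-diag B v with v ≟ᶠ v
  ... | yes _  = refl
  ... | no v≢v = ⊥-elim (v≢v ≡.refl)

  Dinv-diag : ∀ {n} (A : Matrix K n) nz v → Dinv K A nz v v ≈ inv (A v v) (nz v)
  Dinv-diag A nz v with v ≟ᶠ v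
  ... | yes _  = refl
  ... | no v≢v = ⊥-elim (v≢v ≡.refl)

  Dinv-off : ∀ {n} (A : Matrix K n) nz {v k} → k ≢ v → Dinv K A nz v k ≈ 0#
  Dinv-off A nz {v} {k} k≢v with v ≟ᶠ k
  ... | yes v≡k = ⊥-elim (k≢v (≡.sym v≡k))
  ... | no _    = refl

  Dinv-⊛ : ∀ {n} (A : Matrix K n) nz (T : Matrix K n) v j →
    (Dinv K A nz ⊛ T) v j ≈ inv (A v v) (nz v) * T v j
  Dinv-⊛ A nz T v j = begin
    (Dinv K A nz ⊛ T) v j                ≈⟨ ⊛-entry (Dinv K A nz) T v j ⟩
    sum (λ k → Dinv K A nz v k * T k j)  ≈⟨ sum-single _ v (λ k k≢v → trans (*-congʳ (Dinv-off A nz k≢v)) (zeroˡ (T k j))) ⟩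
    Dinv K A nz v v * T v j              ≈⟨ *-congʳ (Dinv-diag A nz v) ⟩
    inv (A v v) (nz v) * T v j           ∎

  below-from-restriction : ∀ {n} (A : Matrix K n) nz (B : Matrix K n) σ →
    restrict K B σ ≋ (-M_ K (Dinv K A nz ⊛ restrict K A σ)) →
    ∀ {v j} → σ ⟨$⟩ˡ j < σ ⟨$⟩ˡ v → B v j ≈ - (inv (A v v) (nz v) * A v j)
  below-from-restriction A nz B σ hyp {v} {j} j<v = begin
    B v j                                   ≈⟨ restrict-below B σ j<v ⟨
    restrict K B σ v j                      ≈⟨ hyp v j ⟩
    - (Dinv K A nz ⊛ restrict K A σ) v j    ≈⟨ -‿cong (Dinv-⊛ A nz (restrict K A σ) v j) ⟩
    - (inv (A v v) (nz v) * restrict K A σ v j) ≈⟨ -‿cong (*-congˡ (restrict-below A σ j<v)) ⟩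
    - (inv (A v v) (nz v) * A v j)          ∎

  hypotheses⇒invertsRow : ∀ {n} (A : Matrix K n) nz (B : Matrix K n) π →
    restrict K B (reverseπ π) ≋ (-M_ K (Dinv K A nz ⊛ restrict K A (reverseπ π))) →
    restrict K B π ≋ (-M_ K (Dinv K A nz ⊛ restrict K A π)) →
    Diag K B ≋ Dinv K A nz →
    ∀ v → InvertsRow A (B v) v
  hypotheses⇒invertsRow A nz B π hyp-rev hyp-π hyp-diag v = record
    { pivot       = trans (*-congˡ diagonal) (inv-r (A v v) (nz v))
    ; offDiagonal = λ j≢v → trans (off j≢v) (-‿cong (*-congʳ (sym diagonal)))
    }
    where
    diagonal : B v v ≈ inv (A v v) (nz v)
    diagonal = trans (sym (Diag-diag B v)) (trans (hyp-diag v v) (Dinv-diag A nz v))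
    off : ∀ {j} → j ≢ v → B v j ≈ - (inv (A v v) (nz v) * A v j)
    off j≢v with precedes-in-σ-or-reverse π j≢v
    ... | inj₁ j<v = below-from-restriction A nz B π hyp-π j<v
    ... | inj₂ j<v = below-from-restriction A nz B (reverseπ π) hyp-rev j<v

  module Schedule {n} (π : Permutation′ n) where
    open Composites (matrixMonoid n) using (composite; product; composite-inverse; composite-leftInverse⇒All)

    schedule : List (Fin n)
    schedule = tabulate (π ⟨$⟩ʳ_)

    sysMap-composite : ∀ (A : Matrix K n) → sysMap K A π ≡ composite (F K A) schedule
    sysMap-composite A = foldl-positions (λ M v → F K A v ⊛ M) (π ⟨$⟩ʳ_) Id

    sysMap-reverse : ∀ (B : Matrix K n) → sysMap K B (reverseπ π) ≡ product (F K B) schedule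
    sysMap-reverse B = ≡.trans (foldl-positions update ((π ⟨$⟩ʳ_) ∘ opposite) Id)
                               (foldl-opposite update Id (π ⟨$⟩ʳ_))
      where
      update : Matrix K n → Fin n → Matrix K n
      update M v = F K B v ⊛ M

    sysMap-inverse : ∀ (A Y : Matrix K n) → (∀ v → InvertsRow A (Y v) v) →
      IsInverseOf K (sysMap K Y (reverseπ π)) (sysMap K A π)
    sysMap-inverse A Y inverts =
      ≡.subst₂ (IsInverseOf K) (≡.sym (sysMap-reverse Y)) (≡.sym (sysMap-composite A))
        (composite-inverse (F K A) (F K Y)
          (λ v → proj₁ (F-inverse A Y v (inverts v)))
          (λ v → proj₂ (F-inverse A Y v (inverts v)))
          schedule)

    sysMap-leftInvertible⇒pivots≉0 : ∀ (A N : Matrix K n) → N ⊛ sysMap K A π ≋ Id →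
      ∀ i → ¬ (A i i ≈ 0#)
    sysMap-leftInvertible⇒pivots≉0 A N N-left i =
      ≡.subst (λ v → ¬ (A v v ≈ 0#)) (inverseʳ π) (tabulate⁻ all-pivots (π ⟨$⟩ˡ i))
      where
      invertible : ∀ {v} → ¬ (A v v ≈ 0#) → Σ (Matrix K n) (λ H → F K A v ⊛ H ≋ Id)
      invertible {v} a≉0 = _ , proj₁ (F-inverse A (λ _ → invertingRow A v a≉0) v
                                       (invertingRow-inverts A v a≉0))
      all-pivots : All (λ v → ¬ (A v v ≈ 0#)) schedule
      all-pivots = composite-leftInverse⇒All (F K A) (λ v → ¬ (A v v ≈ 0#))
        (λ {v} {L} → F-leftInvertible⇒pivot≉0 A L v) invertible schedule
        (≡.subst (λ M → N ⊛ M ≋ Id) (sysMap-composite A) N-left)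

proposition1 : ∀ {c ℓ : Level} (K : Field c ℓ) {n : ℕ}
    (G : ConnectedSimpleGraph n) (A : Matrix K n) → IsLinearSDS K G A →
    (π : Permutation′ n) →
    (Invertible K (sysMap K A π) ⇔ (∀ i → ¬ (Field._≈_ K (A i i) (Field.0# K))))
    × ((nz : ∀ i → ¬ (Field._≈_ K (A i i) (Field.0# K))) → (B : Matrix K n) →
       _≈M_ K (restrict K B (reverseπ π)) (-M_ K (_*M_ K (Dinv K A nz) (restrict K A (reverseπ π)))) →
       _≈M_ K (restrict K B π) (-M_ K (_*M_ K (Dinv K A nz) (restrict K A π))) →
       _≈M_ K (Diag K B) (Dinv K A nz) →
       IsLinearSDS K G B × IsInverseOf K (sysMap K B (reverseπ π)) (sysMap K A π))
proposition1 K G A A-linear π = mk⇔ necessity sufficiency , inverse-formula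
  where
  open Field K using (_≈_; 0#)
  open Matrices K
  open Schedule π

  necessity : Invertible K (sysMap K A π) → ∀ i → ¬ (A i i ≈ 0#)
  necessity (_ , _ , left-inverse) = sysMap-leftInvertible⇒pivots≉0 A _ left-inverse

  sufficiency : (∀ i → ¬ (A i i ≈ 0#)) → Invertible K (sysMap K A π)
  sufficiency nz = sysMap K Y (reverseπ π) , sysMap-inverse A Y (λ v → invertingRow-inverts A v (nz v))
    where
    Y : Matrix K _
    Y v = invertingRow A v (nz v)

  inverse-formula : (nz : ∀ i → ¬ (A i i ≈ 0#)) → (B : Matrix K _) →
    restrict K B (reverseπ π) ≋ (-M_ K (Dinv K A nz ⊛ restrict K A (reverseπ π))) →
    restrict K B π ≋ (-M_ K (Dinv K A nz ⊛ restrict K A π)) →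
    Diag K B ≋ Dinv K A nz →
    IsLinearSDS K G B × IsInverseOf K (sysMap K B (reverseπ π)) (sysMap K A π)
  inverse-formula nz B hyp-rev hyp-π hyp-diag = B-linear , sysMap-inverse A B B-inverts
    where
    B-inverts : ∀ v → InvertsRow A (B v) v
    B-inverts = hypotheses⇒invertsRow A nz B π hyp-rev hyp-π hyp-diag
    B-linear : IsLinearSDS K G B
    B-linear i j i≢j not-adjacent =
      invertsRow-zeros (B-inverts i) (i≢j ∘ ≡.sym) (A-linear i j i≢j not-adjacent)
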